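{- Let $f:\{ -1,1\}^n\to\{ -1,1\}$ be low-correlation self-predicting. Then either $W^1[f]=0$ or $W^1[f]\ge 1/2$.
   Context: $\hat f_S=\mathbb{E}[f(X^n)\prod_{i\in S}X_i]$ with $X^n$ uniform on $\{ -1,1\}^n$, and $W^1[f]=\sum_{i=1}^n\hat f_{\{i\}}^2$. For $\rho\in[0,1]$, $T_\rho f(y^n)=\sum_{S\subseteq[n]}\rho^{|S|}\hat f_S\prod_{i\in S}y_i$. $\operatorname{sgn}(0)=0$. $f$ is $\rho$-SP if $f(y^n)=\operatorname{sgn}T_\rho f(y^n)$ for all $y^n$ with $T_\rho f(y^n)\ne0$. $f$ is low-correlation self-predicting if there exists $\rho^*>0$ with $f$ $\rho$-SP for all $\rho\in[0,\rho^*)$. -}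

module Defs where

open import Data.Bool using (Bool; true; false; if_then_else_)
open import Data.Nat using (ℕ; zero; suc)
open import Data.Fin using (Fin)
open import Data.Fin.Subset using (Subset; ⁅_⁆; ∣_∣)
open import Data.Vec using (Vec; []; _∷_)
open import Data.List using (List; map; allFin)
open import Data.Rational using (ℚ; 0ℚ; 1ℚ; -_; _+_; _*_; ½; _<_; _≤_)
open import Data.Rational.Properties using (_<?_)
open import Data.Product using (Σ; _×_)
open import Relation.Nullary using (¬_; yes; no)
open import Relation.Binary.PropositionalEquality using (_≡_)

-- A point of the Boolean cube {-1,1}^n, encoded as a Bool vector (true ↦ 1, false ↦ -1).
Cube : ℕ → Set
Cube n = Vec Bool n

val : Bool → ℚ
val true  = 1ℚ
val false = - 1ℚ

BoolFun : ℕ → Set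
BoolFun n = Cube n → Bool

E : (n : ℕ) → (Cube n → ℚ) → ℚ
E zero    g = g []
E (suc n) g = ½ * (E n (λ xs → g (true ∷ xs)) + E n (λ xs → g (false ∷ xs)))

χ : {n : ℕ} → Subset n → Cube n → ℚ
χ []       []       = 1ℚ
χ (s ∷ S) (x ∷ xs) = (if s then val x else 1ℚ) * χ S xs

fhat : {n : ℕ} → BoolFun n → Subset n → ℚ
fhat {n} f S = E n (λ x → val (f x) * χ S x)

sumℚ : List ℚ → ℚ
sumℚ = Data.List.foldr _+_ 0ℚ

W1 : {n : ℕ} → BoolFun n → ℚ
W1 {n} f = sumℚ (map (λ i → fhat f ⁅ i ⁆ * fhat f ⁅ i ⁆) (allFin n))

pow : ℚ → ℕ → ℚ
pow q zero    = 1ℚ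
pow q (suc k) = q * pow q k

allSubsets : (n : ℕ) → List (Subset n)
allSubsets zero    = [] Data.List.∷ Data.List.[]
allSubsets (suc n) =
  map (true ∷_) (allSubsets n) Data.List.++ map (false ∷_) (allSubsets n)

T : {n : ℕ} → ℚ → BoolFun n → Cube n → ℚ
T {n} ρ f y = sumℚ (map (λ S → pow ρ ∣ S ∣ * fhat f S * χ S y) (allSubsets n))

sgn : ℚ → ℚ
sgn q with 0ℚ <? q
... | yes _ = 1ℚ
... | no _ with q <? 0ℚ
...   | yes _ = - 1ℚ
...   | no _  = 0ℚ

SP : {n : ℕ} → ℚ → BoolFun n → Set
SP {n} ρ f = (y : Cube n) → ¬ (T ρ f y ≡ 0ℚ) → val (f y) ≡ sgn (T ρ f y)

LowCorrSP : {n : ℕ} → BoolFun n → Set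
LowCorrSP f = Σ ℚ λ ρ* → (0ℚ < ρ*) × ((ρ : ℚ) → 0ℚ ≤ ρ → ρ < ρ* → SP ρ f)

module Submission where

-- Write c = f̂(∅) and ℓ(y) = Σᵢ f̂({i}) yᵢ, so that W¹[f] = E[ℓ²] and
-- T_ρ f(y) = c + ρ ℓ(y) + O(ρ²) uniformly for ρ ∈ [0,1].
--  * If c ≠ 0, self-prediction at ρ = 0 says f ≡ sgn c is constant, so W¹[f] = 0.
--  * If c = 0, then for ρ > 0 small enough sgn T_ρ f(y) = sgn ℓ(y) whenever
--    ℓ(y) ≠ 0, so f(y) ℓ(y) = |ℓ(y)| everywhere and E|ℓ| = E[f ℓ] = W¹[f].
--    A Khintchine inequality with the sharp constant, E[ℓ²] ≤ 2 (E|ℓ|)², then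
--    gives W¹[f]/2 ≤ W¹[f]², i.e. W¹[f] = 0 or W¹[f] ≥ 1/2.
-- The Khintchine inequality comes from a refined Poincaré inequality,
-- Var g ≤ ½ I[g] + ½ W¹[g] (I = total influence), applied to the even
-- function g = |ℓ|, whose influence is at most E[ℓ²].

open import Defs
open import Function using (_∘_; id)
open import Data.Bool using (true; false; not)
open import Data.Nat using (ℕ; zero; suc)
open import Data.Fin using (Fin; zero; suc)
open import Data.Fin.Subset using (Subset; ⁅_⁆) renaming (⊥ to ∅; ∣_∣ to card)
open import Data.Vec using ([]; _∷_; lookup) renaming (map to mapᵛ)
open import Data.Vec.Properties using (lookup-map)
open import Data.List using (List; map; tabulate; _++_) renaming ([] to []ᴸ; _∷_ to _∷ᴸ_)
open import Data.List.Properties using (map-++; map-∘; map-cong; map-tabulate)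
open import Data.Product using (Σ; _×_; _,_)
open import Data.Sum using (_⊎_; inj₁; inj₂)
open import Data.Empty using (⊥-elim)
open import Relation.Nullary using (¬_; yes; no)
open import Relation.Binary.Definitions using (tri<; tri≈; tri>)
open import Data.Rational
  using (ℚ; 0ℚ; 1ℚ; ½; -_; _+_; _-_; _*_; _≤_; _<_; ∣_∣; _⊓_; 1/_; NonZero; positive; nonNegative)
open import Data.Rational.Properties
open import Relation.Binary.PropositionalEquality
open import Data.Rational.Solver using (module +-*-Solver)
open +-*-Solver using (solve; _:=_; con; _:+_; _:-_; _:*_; :-_)

sq : ℚ → ℚ
sq q = q * q

-- Inequalities are proved by exhibiting the gap q - p, which the ring
-- solver then identifies with a manifestly signed quantity.
add-gap : ∀ {p q d} → d ≡ q - p → p + d ≡ q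
add-gap {p} {q} d≡q-p = trans (cong (p +_) d≡q-p) (solve 2 (λ p q → p :+ (q :- p) := q) refl p q)

≤-from-gap : ∀ {p q d} → 0ℚ ≤ d → d ≡ q - p → p ≤ q
≤-from-gap {p} 0≤d d≡q-p = subst₂ _≤_ (+-identityʳ p) (add-gap d≡q-p) (+-monoʳ-≤ p 0≤d)

<-from-gap : ∀ {p q d} → 0ℚ < d → d ≡ q - p → p < q
<-from-gap {p} 0<d d≡q-p = subst₂ _<_ (+-identityʳ p) (add-gap d≡q-p) (+-monoʳ-< p 0<d)

gap-nonneg : ∀ {p q} → p ≤ q → 0ℚ ≤ q - p
gap-nonneg {p} {q} p≤q = subst (_≤ q - p) (+-inverseʳ p) (+-monoˡ-≤ (- p) p≤q)

gap-pos : ∀ {p q} → p < q → 0ℚ < q - p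
gap-pos {p} {q} p<q = subst (_< q - p) (+-inverseʳ p) (+-monoˡ-< (- p) p<q)

+-nonneg : ∀ {p q} → 0ℚ ≤ p → 0ℚ ≤ q → 0ℚ ≤ p + q
+-nonneg {p} {q} 0≤p 0≤q = subst (_≤ p + q) (+-identityˡ 0ℚ) (+-mono-≤ 0≤p 0≤q)

*-nonneg : ∀ {p q} → 0ℚ ≤ p → 0ℚ ≤ q → 0ℚ ≤ p * q
*-nonneg {p} {q} 0≤p 0≤q = subst (_≤ p * q) (*-zeroʳ p) (*-monoˡ-≤-nonNeg p {{nonNegative 0≤p}} 0≤q)

*-monoˡ-≤-nonneg : ∀ {r p q} → 0ℚ ≤ r → p ≤ q → r * p ≤ r * q
*-monoˡ-≤-nonneg {r} 0≤r = *-monoˡ-≤-nonNeg r {{nonNegative 0≤r}}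

½-nonneg : 0ℚ ≤ ½
½-nonneg = nonNegative⁻¹ ½

q≡-q⇒q≡0 : ∀ {q} → q ≡ - q → q ≡ 0ℚ
q≡-q⇒q≡0 {q} q≡-q = begin
  q             ≡⟨ solve 1 (λ q → q := con ½ :* (q :+ q)) refl q ⟩
  ½ * (q + q)   ≡⟨ cong (λ z → ½ * (q + z)) q≡-q ⟩
  ½ * (q + - q) ≡⟨ solve 1 (λ q → con ½ :* (q :+ :- q) := con 0ℚ) refl q ⟩
  0ℚ            ∎
  where open ≡-Reasoning

∣p∣≡-p-if-neg : ∀ {p} → p < 0ℚ → ∣ p ∣ ≡ - p
∣p∣≡-p-if-neg {p} p<0 with ∣p∣≡p∨∣p∣≡-p p
... | inj₂ ∣p∣≡-p = ∣p∣≡-p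
... | inj₁ ∣p∣≡p  = ⊥-elim (<-irrefl refl (≤-<-trans (∣p∣≡p⇒0≤p ∣p∣≡p) p<0))

p≤∣p∣ : ∀ p → p ≤ ∣ p ∣
p≤∣p∣ p with ∣p∣≡p∨∣p∣≡-p p
... | inj₁ ∣p∣≡p  = ≤-reflexive (sym ∣p∣≡p)
... | inj₂ ∣p∣≡-p = ≤-trans p≤0 (0≤∣p∣ p)
  where
    p≤0 : p ≤ 0ℚ
    p≤0 = ≤-from-gap (subst (0ℚ ≤_) ∣p∣≡-p (0≤∣p∣ p)) (sym (+-identityˡ (- p)))

-p≤∣p∣ : ∀ p → - p ≤ ∣ p ∣
-p≤∣p∣ p = subst (- p ≤_) (∣-p∣≡∣p∣ p) (p≤∣p∣ (- p))

sq-abs : ∀ p → sq ∣ p ∣ ≡ sq p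
sq-abs p with ∣p∣≡p∨∣p∣≡-p p
... | inj₁ ∣p∣≡p  = cong sq ∣p∣≡p
... | inj₂ ∣p∣≡-p = trans (cong sq ∣p∣≡-p) (solve 1 (λ p → (:- p) :* (:- p) := p :* p) refl p)

sq-nonneg : ∀ p → 0ℚ ≤ sq p
sq-nonneg p = subst (0ℚ ≤_) (sq-abs p) (*-nonneg (0≤∣p∣ p) (0≤∣p∣ p))

-- Reverse triangle inequality in squared form: (|p| - |q|)² ≤ (p - q)²,
-- because the two sides differ by 2(|pq| - pq) ≥ 0.
sq-abs-diff : ∀ p q → sq (∣ p ∣ - ∣ q ∣) ≤ sq (p - q)
sq-abs-diff p q = begin
  sq (∣ p ∣ - ∣ q ∣)
    ≡⟨ solve 2 (λ a b → (a :- b) :* (a :- b) := (a :* a :+ b :* b) :- (a :* b :+ a :* b)) refl ∣ p ∣ ∣ q ∣ ⟩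
  (sq ∣ p ∣ + sq ∣ q ∣) - (∣ p ∣ * ∣ q ∣ + ∣ p ∣ * ∣ q ∣)
    ≡⟨ cong₂ (λ s t → s - (t + t)) (cong₂ _+_ (sq-abs p) (sq-abs q)) (sym (∣p*q∣≡∣p∣*∣q∣ p q)) ⟩
  (sq p + sq q) - (∣ p * q ∣ + ∣ p * q ∣)
    ≤⟨ +-monoʳ-≤ (sq p + sq q) (neg-antimono-≤ (+-mono-≤ (p≤∣p∣ (p * q)) (p≤∣p∣ (p * q)))) ⟩
  (sq p + sq q) - (p * q + p * q)
    ≡⟨ solve 2 (λ p q → (p :* p :+ q :* q) :- (p :* q :+ p :* q) := (p :- q) :* (p :- q)) refl p q ⟩
  sq (p - q) ∎
  where open ≤-Reasoning

E-cong : ∀ n {g h : Cube n → ℚ} → (∀ x → g x ≡ h x) → E n g ≡ E n h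
E-cong zero    g≡h = g≡h []
E-cong (suc n) g≡h = cong₂ (λ s t → ½ * (s + t))
  (E-cong n (λ x → g≡h (true ∷ x))) (E-cong n (λ x → g≡h (false ∷ x)))

E-const : ∀ n c → E n (λ _ → c) ≡ c
E-const zero    c = refl
E-const (suc n) c = trans (cong₂ (λ s t → ½ * (s + t)) (E-const n c) (E-const n c))
  (solve 1 (λ c → con ½ :* (c :+ c) := c) refl c)

E-+ : ∀ n (g h : Cube n → ℚ) → E n (λ x → g x + h x) ≡ E n g + E n h
E-+ zero    g h = refl
E-+ (suc n) g h = trans (cong₂ (λ s t → ½ * (s + t)) (E-+ n _ _) (E-+ n _ _))
  (solve 4 (λ a b c d → con ½ :* ((a :+ b) :+ (c :+ d)) := con ½ :* (a :+ c) :+ con ½ :* (b :+ d)) refl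
     (E n (λ x → g (true ∷ x))) (E n (λ x → h (true ∷ x))) (E n (λ x → g (false ∷ x))) (E n (λ x → h (false ∷ x))))

E-scale : ∀ n c (g : Cube n → ℚ) → E n (λ x → c * g x) ≡ c * E n g
E-scale zero    c g = refl
E-scale (suc n) c g = trans (cong₂ (λ s t → ½ * (s + t)) (E-scale n c _) (E-scale n c _))
  (solve 3 (λ c a b → con ½ :* (c :* a :+ c :* b) := c :* (con ½ :* (a :+ b))) refl
     c (E n (λ x → g (true ∷ x))) (E n (λ x → g (false ∷ x))))

E-negate : ∀ n (g : Cube n → ℚ) → E n (λ x → - g x) ≡ - E n g
E-negate zero    g = refl
E-negate (suc n) g = trans (cong₂ (λ s t → ½ * (s + t)) (E-negate n _) (E-negate n _))
  (solve 2 (λ a b → con ½ :* (:- a :+ :- b) := :- (con ½ :* (a :+ b))) refl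
     (E n (λ x → g (true ∷ x))) (E n (λ x → g (false ∷ x))))

E-mono : ∀ n {g h : Cube n → ℚ} → (∀ x → g x ≤ h x) → E n g ≤ E n h
E-mono zero    g≤h = g≤h []
E-mono (suc n) g≤h = *-monoˡ-≤-nonneg ½-nonneg
  (+-mono-≤ (E-mono n (λ x → g≤h (true ∷ x))) (E-mono n (λ x → g≤h (false ∷ x))))

E-nonneg : ∀ n {g : Cube n → ℚ} → (∀ x → 0ℚ ≤ g x) → 0ℚ ≤ E n g
E-nonneg n {g} 0≤g = subst (_≤ E n g) (E-const n 0ℚ) (E-mono n 0≤g)

-- The antipodal map x ↦ -x preserves the uniform measure; hence odd
-- functions have mean zero.
flip : ∀ {n} → Cube n → Cube n
flip = mapᵛ not

E-flip : ∀ n (g : Cube n → ℚ) → E n (g ∘ flip) ≡ E n g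
E-flip zero    g = refl
E-flip (suc n) g = trans (cong₂ (λ s t → ½ * (s + t)) (E-flip n _) (E-flip n _))
  (cong (½ *_) (+-comm (E n (λ x → g (false ∷ x))) (E n (λ x → g (true ∷ x)))))

Even Odd : ∀ n → (Cube n → ℚ) → Set
Even n g = ∀ x → g (flip x) ≡ g x
Odd  n g = ∀ x → g (flip x) ≡ - g x

E-odd : ∀ n (g : Cube n → ℚ) → Odd n g → E n g ≡ 0ℚ
E-odd n g odd = q≡-q⇒q≡0 (begin
  E n g               ≡⟨ sym (E-flip n g) ⟩
  E n (g ∘ flip)      ≡⟨ E-cong n odd ⟩
  E n (λ x → - g x)   ≡⟨ E-negate n g ⟩
  - E n g             ∎)
  where open ≡-Reasoning

-- Splitting off the first coordinate: g(x₀, x) = avg₀ g x + x₀ · der₀ g x.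
avg₀ der₀ : ∀ {n} → (Cube (suc n) → ℚ) → Cube n → ℚ
avg₀ g x = ½ * (g (true ∷ x) + g (false ∷ x))
der₀ g x = ½ * (g (true ∷ x) - g (false ∷ x))

E-avg₀ : ∀ n (g : Cube (suc n) → ℚ) → E n (avg₀ g) ≡ E (suc n) g
E-avg₀ n g = trans (E-scale n ½ _) (cong (½ *_) (E-+ n _ _))

E-parallelogram : ∀ n (u v : Cube n → ℚ) →
  E n (λ x → sq (½ * (u x + v x))) + E n (λ x → sq (½ * (u x - v x)))
    ≡ ½ * (E n (λ x → sq (u x)) + E n (λ x → sq (v x)))
E-parallelogram n u v = begin
  E n (λ x → sq (½ * (u x + v x))) + E n (λ x → sq (½ * (u x - v x)))
    ≡⟨ sym (E-+ n _ _) ⟩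
  E n (λ x → sq (½ * (u x + v x)) + sq (½ * (u x - v x)))
    ≡⟨ E-cong n (λ x → solve 2 (λ a b →
         (con ½ :* (a :+ b)) :* (con ½ :* (a :+ b)) :+ (con ½ :* (a :- b)) :* (con ½ :* (a :- b))
           := con ½ :* (a :* a :+ b :* b)) refl (u x) (v x)) ⟩
  E n (λ x → ½ * (sq (u x) + sq (v x)))
    ≡⟨ E-scale n ½ _ ⟩
  ½ * E n (λ x → sq (u x) + sq (v x))
    ≡⟨ cong (½ *_) (E-+ n _ _) ⟩
  ½ * (E n (λ x → sq (u x)) + E n (λ x → sq (v x))) ∎
  where open ≡-Reasoning

-- Variance, total influence I[g] = Σᵢ E[(Dᵢ g)²], and level-one weight
-- Σᵢ ĝ({i})², the latter two by recursion on the first coordinate.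
Var : ∀ n → (Cube n → ℚ) → ℚ
Var n g = E n (λ x → sq (g x)) - sq (E n g)

Inf : ∀ n → (Cube n → ℚ) → ℚ
Inf zero    g = 0ℚ
Inf (suc n) g = E n (λ x → sq (der₀ g x))
              + ½ * (Inf n (λ x → g (true ∷ x)) + Inf n (λ x → g (false ∷ x)))

Lvl1 : ∀ n → (Cube n → ℚ) → ℚ
Lvl1 zero    g = 0ℚ
Lvl1 (suc n) g = sq (E n (der₀ g)) + Lvl1 n (avg₀ g)

Inf-cong : ∀ n {g h : Cube n → ℚ} → (∀ x → g x ≡ h x) → Inf n g ≡ Inf n h
Inf-cong zero    g≡h = refl
Inf-cong (suc n) g≡h = cong₂ _+_
  (E-cong n (λ x → cong (λ z → sq (½ * z)) (cong₂ _-_ (g≡h (true ∷ x)) (g≡h (false ∷ x)))))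
  (cong₂ (λ s t → ½ * (s + t)) (Inf-cong n (λ x → g≡h (true ∷ x))) (Inf-cong n (λ x → g≡h (false ∷ x))))

Inf-nonneg : ∀ n (g : Cube n → ℚ) → 0ℚ ≤ Inf n g
Inf-nonneg zero    g = ≤-refl
Inf-nonneg (suc n) g = +-nonneg (E-nonneg n (λ x → sq-nonneg (der₀ g x)))
  (*-nonneg ½-nonneg (+-nonneg (Inf-nonneg n _) (Inf-nonneg n _)))

-- Influence is a quadratic form, so it satisfies the parallelogram law.
Inf-parallelogram : ∀ n (p q : Cube n → ℚ) →
  ½ * (Inf n p + Inf n q) ≡ Inf n (λ x → ½ * (p x + q x)) + Inf n (λ x → ½ * (p x - q x))
Inf-parallelogram zero    p q = refl
Inf-parallelogram (suc n) p q = begin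
  ½ * ((A + ½ * (Inf n pT + Inf n pF)) + (B + ½ * (Inf n qT + Inf n qF)))
    ≡⟨ solve 6 (λ A B a b c d → con ½ :* ((A :+ con ½ :* (a :+ b)) :+ (B :+ con ½ :* (c :+ d)))
                 := con ½ :* (A :+ B) :+ con ½ :* (con ½ :* (a :+ c) :+ con ½ :* (b :+ d))) refl
         A B (Inf n pT) (Inf n pF) (Inf n qT) (Inf n qF) ⟩
  ½ * (A + B) + ½ * (½ * (Inf n pT + Inf n qT) + ½ * (Inf n pF + Inf n qF))
    ≡⟨ cong₂ (λ s t → s + ½ * t) (sym derivative-part)
         (cong₂ _+_ (Inf-parallelogram n pT qT) (Inf-parallelogram n pF qF)) ⟩
  (C + D) + ½ * ((Inf n (mid pT qT) + Inf n (half-diff pT qT)) + (Inf n (mid pF qF) + Inf n (half-diff pF qF)))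
    ≡⟨ solve 6 (λ C D a b c d → (C :+ D) :+ con ½ :* ((a :+ b) :+ (c :+ d))
                 := (C :+ con ½ :* (a :+ c)) :+ (D :+ con ½ :* (b :+ d))) refl
         C D (Inf n (mid pT qT)) (Inf n (half-diff pT qT)) (Inf n (mid pF qF)) (Inf n (half-diff pF qF)) ⟩
  (C + ½ * (Inf n (mid pT qT) + Inf n (mid pF qF))) + (D + ½ * (Inf n (half-diff pT qT) + Inf n (half-diff pF qF))) ∎
  where
    open ≡-Reasoning
    mid half-diff : (Cube n → ℚ) → (Cube n → ℚ) → Cube n → ℚ
    mid       u v x = ½ * (u x + v x)
    half-diff u v x = ½ * (u x - v x)
    pT pF qT qF : Cube n → ℚ
    pT x = p (true ∷ x)
    pF x = p (false ∷ x)
    qT x = q (true ∷ x)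
    qF x = q (false ∷ x)
    A B C D : ℚ
    A = E n (λ x → sq (der₀ p x))
    B = E n (λ x → sq (der₀ q x))
    C = E n (λ x → sq (der₀ (λ y → ½ * (p y + q y)) x))
    D = E n (λ x → sq (der₀ (λ y → ½ * (p y - q y)) x))
    -- der₀ is linear, so the derivative terms obey the parallelogram law too.
    derivative-part : C + D ≡ ½ * (A + B)
    derivative-part = trans
      (cong₂ _+_
        (E-cong n (λ x → cong sq (solve 4 (λ a b c d →
           con ½ :* (con ½ :* (a :+ c) :- con ½ :* (b :+ d)) := con ½ :* (con ½ :* (a :- b) :+ con ½ :* (c :- d)))
           refl (pT x) (pF x) (qT x) (qF x))))
        (E-cong n (λ x → cong sq (solve 4 (λ a b c d →
           con ½ :* (con ½ :* (a :- c) :- con ½ :* (b :- d)) := con ½ :* (con ½ :* (a :- b) :- con ½ :* (c :- d)))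
           refl (pT x) (pF x) (qT x) (qF x)))))
      (E-parallelogram n (der₀ p) (der₀ q))

Var-step : ∀ n (g : Cube (suc n) → ℚ) → Var (suc n) g ≡ Var n (avg₀ g) + E n (λ x → sq (der₀ g x))
Var-step n g = begin
  E (suc n) (λ x → sq (g x)) - sq (E (suc n) g)
    ≡⟨ cong₂ (λ s t → s - sq t) (sym (E-parallelogram n (λ x → g (true ∷ x)) (λ x → g (false ∷ x)))) (sym (E-avg₀ n g)) ⟩
  (E n (λ x → sq (avg₀ g x)) + E n (λ x → sq (der₀ g x))) - sq (E n (avg₀ g))
    ≡⟨ solve 3 (λ U V w → (U :+ V) :- w :* w := (U :- w :* w) :+ V) refl
         (E n (λ x → sq (avg₀ g x))) (E n (λ x → sq (der₀ g x))) (E n (avg₀ g)) ⟩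
  Var n (avg₀ g) + E n (λ x → sq (der₀ g x)) ∎
  where open ≡-Reasoning

Inf-step : ∀ n (g : Cube (suc n) → ℚ) →
  Inf (suc n) g ≡ E n (λ x → sq (der₀ g x)) + (Inf n (avg₀ g) + Inf n (der₀ g))
Inf-step n g = cong (E n (λ x → sq (der₀ g x)) +_) (Inf-parallelogram n _ _)

poincare : ∀ n (g : Cube n → ℚ) → Var n g ≤ Inf n g
poincare zero    g = ≤-reflexive (solve 1 (λ a → a :* a :- a :* a := con 0ℚ) refl (g []))
poincare (suc n) g = begin
  Var (suc n) g                             ≡⟨ Var-step n g ⟩
  Var n (avg₀ g) + V                        ≤⟨ +-monoˡ-≤ V (poincare n (avg₀ g)) ⟩
  Inf n (avg₀ g) + V                        ≤⟨ ≤-from-gap (Inf-nonneg n (der₀ g)) gap ⟩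
  V + (Inf n (avg₀ g) + Inf n (der₀ g))     ≡⟨ sym (Inf-step n g) ⟩
  Inf (suc n) g                             ∎
  where
    open ≤-Reasoning
    V : ℚ
    V = E n (λ x → sq (der₀ g x))
    gap : Inf n (der₀ g) ≡ (V + (Inf n (avg₀ g) + Inf n (der₀ g))) - (Inf n (avg₀ g) + V)
    gap = solve 3 (λ V a b → b := (V :+ (a :+ b)) :- (a :+ V)) refl V (Inf n (avg₀ g)) (Inf n (der₀ g))

-- Refined Poincaré inequality Var g ≤ ½ I[g] + ½ W¹[g]: in Fourier terms
-- ĝ(S)² ≤ ½|S| ĝ(S)² for |S| ≥ 2 and ĝ(S)² = ½ ĝ(S)² + ½ ĝ(S)² for |S| = 1.
poincare-level1 : ∀ n (g : Cube n → ℚ) → Var n g ≤ ½ * Inf n g + ½ * Lvl1 n g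
poincare-level1 zero    g =
  ≤-reflexive (solve 1 (λ a → a :* a :- a :* a := con ½ :* con 0ℚ :+ con ½ :* con 0ℚ) refl (g []))
poincare-level1 (suc n) g = begin
  Var (suc n) g
    ≡⟨ Var-step n g ⟩
  Var n (avg₀ g) + V
    ≤⟨ +-monoˡ-≤ V (poincare-level1 n (avg₀ g)) ⟩
  (½ * Inf n (avg₀ g) + ½ * Lvl1 n (avg₀ g)) + V
    ≤⟨ ≤-from-gap (*-nonneg ½-nonneg (gap-nonneg (poincare n (der₀ g)))) gap ⟩
  ½ * (V + (Inf n (avg₀ g) + Inf n (der₀ g))) + ½ * (sq (E n (der₀ g)) + Lvl1 n (avg₀ g))
    ≡⟨ cong (λ z → ½ * z + ½ * Lvl1 (suc n) g) (sym (Inf-step n g)) ⟩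
  ½ * Inf (suc n) g + ½ * Lvl1 (suc n) g ∎
  where
    open ≤-Reasoning
    V : ℚ
    V = E n (λ x → sq (der₀ g x))
    gap : ½ * (Inf n (der₀ g) - Var n (der₀ g))
        ≡ (½ * (V + (Inf n (avg₀ g) + Inf n (der₀ g))) + ½ * (sq (E n (der₀ g)) + Lvl1 n (avg₀ g)))
          - ((½ * Inf n (avg₀ g) + ½ * Lvl1 n (avg₀ g)) + V)
    gap = solve 5 (λ V a b w l → con ½ :* (b :- (V :- w))
                   := (con ½ :* (V :+ (a :+ b)) :+ con ½ :* (w :+ l)) :- ((con ½ :* a :+ con ½ :* l) :+ V))
            refl V (Inf n (avg₀ g)) (Inf n (der₀ g)) (sq (E n (der₀ g))) (Lvl1 n (avg₀ g))

-- Even functions have no level-one weight: each first-coordinate derivative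
-- is odd (mean zero) and each average is again even.
Lvl1-even : ∀ n (g : Cube n → ℚ) → Even n g → Lvl1 n g ≡ 0ℚ
Lvl1-even zero    g even = refl
Lvl1-even (suc n) g even =
  cong₂ (λ s t → sq s + t) (E-odd n (der₀ g) der-odd) (Lvl1-even n (avg₀ g) avg-even)
  where
    der-odd : Odd n (der₀ g)
    der-odd x = trans (cong₂ (λ s t → ½ * (s - t)) (even (false ∷ x)) (even (true ∷ x)))
      (solve 2 (λ a b → con ½ :* (b :- a) := :- (con ½ :* (a :- b))) refl (g (true ∷ x)) (g (false ∷ x)))
    avg-even : Even n (avg₀ g)
    avg-even x = trans (cong₂ (λ s t → ½ * (s + t)) (even (false ∷ x)) (even (true ∷ x)))
      (cong (½ *_) (+-comm (g (false ∷ x)) (g (true ∷ x))))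

sumFin : ∀ n → (Fin n → ℚ) → ℚ
sumFin zero    h = 0ℚ
sumFin (suc n) h = h zero + sumFin n (λ i → h (suc i))

sumFin-cong : ∀ n {g h : Fin n → ℚ} → (∀ i → g i ≡ h i) → sumFin n g ≡ sumFin n h
sumFin-cong zero    g≡h = refl
sumFin-cong (suc n) g≡h = cong₂ _+_ (g≡h zero) (sumFin-cong n (λ i → g≡h (suc i)))

sumFin-zero : ∀ n → sumFin n (λ _ → 0ℚ) ≡ 0ℚ
sumFin-zero zero    = refl
sumFin-zero (suc n) = trans (+-identityˡ _) (sumFin-zero n)

sumFin-scale : ∀ n c (h : Fin n → ℚ) → c * sumFin n h ≡ sumFin n (λ i → c * h i)
sumFin-scale zero    c h = *-zeroʳ c
sumFin-scale (suc n) c h = trans (*-distribˡ-+ c _ _) (cong (c * h zero +_) (sumFin-scale n c _))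

E-sumFin : ∀ n m (h : Fin m → Cube n → ℚ) → E n (λ x → sumFin m (λ i → h i x)) ≡ sumFin m (λ i → E n (h i))
E-sumFin n zero    h = E-const n 0ℚ
E-sumFin n (suc m) h = trans (E-+ n _ _) (cong (E n (h zero) +_) (E-sumFin n m (λ i → h (suc i))))

lin : ∀ n → (Fin n → ℚ) → Cube n → ℚ
lin n a x = sumFin n (λ i → a i * val (lookup x i))

ssq : ∀ n → (Fin n → ℚ) → ℚ
ssq n a = sumFin n (λ i → sq (a i))

ssq-nonneg : ∀ n a → 0ℚ ≤ ssq n a
ssq-nonneg zero    a = ≤-refl
ssq-nonneg (suc n) a = +-nonneg (sq-nonneg (a zero)) (ssq-nonneg n (λ i → a (suc i)))

val-not : ∀ b → val (not b) ≡ - val b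
val-not true  = refl
val-not false = refl

lin-odd : ∀ n a → Odd n (lin n a)
lin-odd zero    a []      = refl
lin-odd (suc n) a (b ∷ x) =
  trans (cong₂ (λ s t → a zero * s + t) (val-not b) (lin-odd n (λ i → a (suc i)) x))
        (solve 3 (λ a v l → a :* (:- v) :+ (:- l) := :- (a :* v :+ l)) refl
           (a zero) (val b) (lin n (λ i → a (suc i)) x))

-- Orthonormality of the coordinates: E[(c + ℓ_a)²] = c² + ‖a‖².
E-sq-affine : ∀ n a c → E n (λ x → sq (c + lin n a x)) ≡ sq c + ssq n a
E-sq-affine zero    a c = solve 1 (λ c → (c :+ con 0ℚ) :* (c :+ con 0ℚ) := c :* c :+ con 0ℚ) refl c
E-sq-affine (suc n) a c = trans
  (cong₂ (λ s t → ½ * (s + t))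
    (trans (E-cong n (λ x → cong sq (sym (+-assoc c (a₀ * 1ℚ) (lin n a′ x))))) (E-sq-affine n a′ (c + a₀ * 1ℚ)))
    (trans (E-cong n (λ x → cong sq (sym (+-assoc c (a₀ * - 1ℚ) (lin n a′ x))))) (E-sq-affine n a′ (c + a₀ * - 1ℚ))))
  (solve 3 (λ c a s → con ½ :* (((c :+ a :* con 1ℚ) :* (c :+ a :* con 1ℚ) :+ s) :+ ((c :+ a :* con (- 1ℚ)) :* (c :+ a :* con (- 1ℚ)) :+ s))
                     := c :* c :+ (a :* a :+ s)) refl c a₀ (ssq n a′))
  where
    a₀ : ℚ
    a₀ = a zero
    a′ : Fin n → ℚ
    a′ i = a (suc i)

-- Pointwise: flipping x₀ changes |c + ℓ_a(x)| by at most 2|a₀|, so the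
-- squared first-coordinate derivative of |c + ℓ_a| is at most a₀².
der-abs-affine : ∀ c a l → sq (½ * (∣ c + (a * 1ℚ + l) ∣ - ∣ c + (a * - 1ℚ + l) ∣)) ≤ sq a
der-abs-affine c a l = begin
  sq (½ * (∣ X ∣ - ∣ Y ∣))    ≡⟨ solve 1 (λ u → (con ½ :* u) :* (con ½ :* u) := (con ½ :* con ½) :* (u :* u)) refl (∣ X ∣ - ∣ Y ∣) ⟩
  (½ * ½) * sq (∣ X ∣ - ∣ Y ∣) ≤⟨ *-monoˡ-≤-nonneg (*-nonneg ½-nonneg ½-nonneg) (sq-abs-diff X Y) ⟩
  (½ * ½) * sq (X - Y)         ≡⟨ solve 3 (λ c a l → (con ½ :* con ½) :* (((c :+ (a :* con 1ℚ :+ l)) :- (c :+ (a :* con (- 1ℚ) :+ l)))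
                                     :* ((c :+ (a :* con 1ℚ :+ l)) :- (c :+ (a :* con (- 1ℚ) :+ l)))) := a :* a) refl c a l ⟩
  sq a                         ∎
  where
    open ≤-Reasoning
    X Y : ℚ
    X = c + (a * 1ℚ + l)
    Y = c + (a * - 1ℚ + l)

Inf-abs-affine : ∀ n a c → Inf n (λ x → ∣ c + lin n a x ∣) ≤ ssq n a
Inf-abs-affine zero    a c = ≤-refl
Inf-abs-affine (suc n) a c = +-mono-≤ derivative-bound restriction-bound
  where
    a₀ : ℚ
    a₀ = a zero
    a′ : Fin n → ℚ
    a′ i = a (suc i)
    derivative-bound : E n (λ x → sq (der₀ (λ y → ∣ c + lin (suc n) a y ∣) x)) ≤ sq a₀
    derivative-bound = ≤-trans (E-mono n (λ x → der-abs-affine c a₀ (lin n a′ x))) (≤-reflexive (E-const n (sq a₀)))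
    restriction : ∀ v → Inf n (λ x → ∣ c + (a₀ * v + lin n a′ x) ∣) ≤ ssq n a′
    restriction v = ≤-trans (≤-reflexive (Inf-cong n (λ x → cong ∣_∣ (sym (+-assoc c (a₀ * v) (lin n a′ x))))))
                            (Inf-abs-affine n a′ (c + a₀ * v))
    restriction-bound : ½ * (Inf n (λ x → ∣ c + (a₀ * 1ℚ + lin n a′ x) ∣) + Inf n (λ x → ∣ c + (a₀ * - 1ℚ + lin n a′ x) ∣))
                        ≤ ssq n a′
    restriction-bound = ≤-trans (*-monoˡ-≤-nonneg ½-nonneg (+-mono-≤ (restriction 1ℚ) (restriction (- 1ℚ))))
                                (≤-reflexive (solve 1 (λ s → con ½ :* (s :+ s) := s) refl (ssq n a′)))

-- For g = |ℓ_a| (even, since ℓ_a is odd): E[g²] = ‖a‖², W¹[g] = 0 and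
-- I[g] ≤ ‖a‖², so the refined Poincaré inequality gives ‖a‖² - (E g)² ≤ ½‖a‖².
khintchine : ∀ n a → ½ * ssq n a ≤ sq (E n (λ x → ∣ lin n a x ∣))
khintchine n a = ≤-from-gap (gap-nonneg variance-bound)
  (solve 2 (λ S s → con ½ :* S :- (S :- s) := s :- con ½ :* S) refl S (sq (E n g)))
  where
    g : Cube n → ℚ
    g x = ∣ lin n a x ∣
    S : ℚ
    S = ssq n a
    drop-zero : ∀ x → ∣ 0ℚ + lin n a x ∣ ≡ g x
    drop-zero x = cong ∣_∣ (+-identityˡ (lin n a x))
    second-moment : E n (λ x → sq (g x)) ≡ S
    second-moment = trans (E-cong n (λ x → trans (sq-abs (lin n a x)) (cong sq (sym (+-identityˡ (lin n a x))))))
                          (trans (E-sq-affine n a 0ℚ) (+-identityˡ S))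
    g-even : Even n g
    g-even x = trans (cong ∣_∣ (lin-odd n a x)) (∣-p∣≡∣p∣ (lin n a x))
    influence-bound : Inf n g ≤ S
    influence-bound = ≤-trans (≤-reflexive (sym (Inf-cong n drop-zero))) (Inf-abs-affine n a 0ℚ)
    variance-bound : S - sq (E n g) ≤ ½ * S
    variance-bound = begin
      S - sq (E n g)               ≡⟨ cong (_- sq (E n g)) (sym second-moment) ⟩
      Var n g                      ≤⟨ poincare-level1 n g ⟩
      ½ * Inf n g + ½ * Lvl1 n g   ≡⟨ cong (λ z → ½ * Inf n g + ½ * z) (Lvl1-even n g g-even) ⟩
      ½ * Inf n g + ½ * 0ℚ         ≤⟨ +-monoˡ-≤ (½ * 0ℚ) (*-monoˡ-≤-nonneg ½-nonneg influence-bound) ⟩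
      ½ * S + ½ * 0ℚ               ≡⟨ solve 1 (λ S → con ½ :* S :+ con ½ :* con 0ℚ := con ½ :* S) refl S ⟩
      ½ * S                        ∎
      where open ≤-Reasoning

χ-∅ : ∀ n (x : Cube n) → χ (∅ {n}) x ≡ 1ℚ
χ-∅ zero    []      = refl
χ-∅ (suc n) (b ∷ x) = trans (*-identityˡ _) (χ-∅ n x)

χ-singleton : ∀ n (i : Fin n) (x : Cube n) → χ ⁅ i ⁆ x ≡ val (lookup x i)
χ-singleton (suc n) zero    (b ∷ x) = trans (cong (val b *_) (χ-∅ n x)) (*-identityʳ (val b))
χ-singleton (suc n) (suc i) (b ∷ x) = trans (*-identityˡ _) (χ-singleton n i x)

E-coordinate : ∀ n (i : Fin n) → E n (λ x → val (lookup x i)) ≡ 0ℚ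
E-coordinate n i = E-odd n (λ x → val (lookup x i)) (λ x → trans (cong val (lookup-map i not x)) (val-not (lookup x i)))

coef : ∀ {n} → BoolFun n → Fin n → ℚ
coef f i = fhat f ⁅ i ⁆

coef-correlation : ∀ n (f : BoolFun n) i → coef f i ≡ E n (λ x → val (f x) * val (lookup x i))
coef-correlation n f i = E-cong n (λ x → cong (val (f x) *_) (χ-singleton n i x))

sumℚ-tabulate : ∀ n (h : Fin n → ℚ) → sumℚ (tabulate h) ≡ sumFin n h
sumℚ-tabulate zero    h = refl
sumℚ-tabulate (suc n) h = cong (h zero +_) (sumℚ-tabulate n (λ i → h (suc i)))

W1≡ssq : ∀ n (f : BoolFun n) → W1 f ≡ ssq n (coef f)
W1≡ssq n f = trans (cong sumℚ (map-tabulate id (λ i → sq (coef f i)))) (sumℚ-tabulate n _)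

E-mul-lin : ∀ n (F : Cube n → ℚ) a → E n (λ x → F x * lin n a x) ≡ sumFin n (λ i → a i * E n (λ x → F x * val (lookup x i)))
E-mul-lin n F a = begin
  E n (λ x → F x * lin n a x)
    ≡⟨ E-cong n (λ x → trans (sumFin-scale n (F x) _) (sumFin-cong n (λ i →
         solve 3 (λ F a v → F :* (a :* v) := a :* (F :* v)) refl (F x) (a i) (val (lookup x i))))) ⟩
  E n (λ x → sumFin n (λ i → a i * (F x * val (lookup x i))))
    ≡⟨ E-sumFin n n _ ⟩
  sumFin n (λ i → E n (λ x → a i * (F x * val (lookup x i))))
    ≡⟨ sumFin-cong n (λ i → E-scale n (a i) _) ⟩
  sumFin n (λ i → a i * E n (λ x → F x * val (lookup x i))) ∎
  where open ≡-Reasoning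

E-f-lin : ∀ n (f : BoolFun n) → E n (λ x → val (f x) * lin n (coef f) x) ≡ ssq n (coef f)
E-f-lin n f = trans (E-mul-lin n (λ x → val (f x)) (coef f))
  (sumFin-cong n (λ i → cong (coef f i *_) (sym (coef-correlation n f i))))

W1-constant : ∀ n (f : BoolFun n) s → (∀ y → val (f y) ≡ s) → W1 f ≡ 0ℚ
W1-constant n f s f≡s = begin
  W1 f                           ≡⟨ W1≡ssq n f ⟩
  sumFin n (λ i → sq (coef f i)) ≡⟨ sumFin-cong n (λ i → cong sq (coef-vanishes i)) ⟩
  sumFin n (λ _ → sq 0ℚ)         ≡⟨ sumFin-zero n ⟩
  0ℚ                             ∎
  where
    open ≡-Reasoning
    coef-vanishes : ∀ i → coef f i ≡ 0ℚ
    coef-vanishes i = begin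
      coef f i                                ≡⟨ coef-correlation n f i ⟩
      E n (λ x → val (f x) * val (lookup x i)) ≡⟨ E-cong n (λ x → cong (_* val (lookup x i)) (f≡s x)) ⟩
      E n (λ x → s * val (lookup x i))         ≡⟨ E-scale n s _ ⟩
      s * E n (λ x → val (lookup x i))         ≡⟨ cong (s *_) (E-coordinate n i) ⟩
      s * 0ℚ                                   ≡⟨ *-zeroʳ s ⟩
      0ℚ                                       ∎

sumℚ-++ : ∀ xs ys → sumℚ (xs ++ ys) ≡ sumℚ xs + sumℚ ys
sumℚ-++ []ᴸ        ys = sym (+-identityˡ _)
sumℚ-++ (x ∷ᴸ xs) ys = trans (cong (x +_) (sumℚ-++ xs ys)) (sym (+-assoc x _ _))

sumℚ-zeros : ∀ {A : Set} (xs : List A) → sumℚ (map (λ _ → 0ℚ) xs) ≡ 0ℚ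
sumℚ-zeros []ᴸ        = refl
sumℚ-zeros (x ∷ᴸ xs) = trans (+-identityˡ _) (sumℚ-zeros xs)

sumℚ-abs-nonneg : ∀ {A : Set} (h : A → ℚ) (xs : List A) → 0ℚ ≤ sumℚ (map (λ a → ∣ h a ∣) xs)
sumℚ-abs-nonneg h []ᴸ        = ≤-refl
sumℚ-abs-nonneg h (x ∷ᴸ xs) = +-nonneg (0≤∣p∣ (h x)) (sumℚ-abs-nonneg h xs)

sum-allSubsets-suc : ∀ n (h : Subset (suc n) → ℚ) →
  sumℚ (map h (allSubsets (suc n)))
    ≡ sumℚ (map (h ∘ (true ∷_)) (allSubsets n)) + sumℚ (map (h ∘ (false ∷_)) (allSubsets n))
sum-allSubsets-suc n h = begin
  sumℚ (map h (map (true ∷_) Ss ++ map (false ∷_) Ss))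
    ≡⟨ cong sumℚ (map-++ h (map (true ∷_) Ss) (map (false ∷_) Ss)) ⟩
  sumℚ (map h (map (true ∷_) Ss) ++ map h (map (false ∷_) Ss))
    ≡⟨ sumℚ-++ (map h (map (true ∷_) Ss)) (map h (map (false ∷_) Ss)) ⟩
  sumℚ (map h (map (true ∷_) Ss)) + sumℚ (map h (map (false ∷_) Ss))
    ≡⟨ sym (cong₂ _+_ (cong sumℚ (map-∘ Ss)) (cong sumℚ (map-∘ Ss))) ⟩
  sumℚ (map (h ∘ (true ∷_)) Ss) + sumℚ (map (h ∘ (false ∷_)) Ss) ∎
  where
    open ≡-Reasoning
    Ss : List (Subset n)
    Ss = allSubsets n

-- The degree-0 and degree-1 parts of a monomial ρᵏ q in the variable ρ.
deg0 : ℕ → ℚ → ℚ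
deg0 zero    q = q
deg0 (suc _) q = 0ℚ

deg1 : ℕ → ℚ → ℚ
deg1 zero    q = 0ℚ
deg1 (suc k) q = deg0 k q

sum-deg0 : ∀ n (c : Subset n → ℚ) → sumℚ (map (λ S → deg0 (card S) (c S)) (allSubsets n)) ≡ c ∅
sum-deg0 zero    c = +-identityʳ (c [])
sum-deg0 (suc n) c = trans (sum-allSubsets-suc n _)
  (trans (cong₂ _+_ (sumℚ-zeros (allSubsets n)) (sum-deg0 n (λ S → c (false ∷ S)))) (+-identityˡ _))

sum-deg1 : ∀ n (c : Subset n → ℚ) → sumℚ (map (λ S → deg1 (card S) (c S)) (allSubsets n)) ≡ sumFin n (λ i → c ⁅ i ⁆)
sum-deg1 zero    c = refl
sum-deg1 (suc n) c = trans (sum-allSubsets-suc n _)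
  (cong₂ _+_ (sum-deg0 n (λ S → c (true ∷ S))) (sum-deg1 n (λ S → c (false ∷ S))))

pow-unit-interval : ∀ {ρ} → 0ℚ ≤ ρ → ρ ≤ 1ℚ → ∀ m → (0ℚ ≤ pow ρ m) × (pow ρ m ≤ 1ℚ)
pow-unit-interval 0≤ρ ρ≤1 zero = ≤-trans 0≤ρ ρ≤1 , ≤-refl
pow-unit-interval {ρ} 0≤ρ ρ≤1 (suc m) with pow-unit-interval 0≤ρ ρ≤1 m
... | 0≤P , P≤1 = *-nonneg 0≤ρ 0≤P , ≤-trans (*-monoˡ-≤-nonneg 0≤ρ P≤1) (≤-trans (≤-reflexive (*-identityʳ ρ)) ρ≤1)

pow-truncation : ∀ {ρ} → 0ℚ ≤ ρ → ρ ≤ 1ℚ → ∀ k q →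
  ∣ pow ρ k * q - (deg0 k q + ρ * deg1 k q) ∣ ≤ ρ * ρ * ∣ q ∣
pow-truncation {ρ} 0≤ρ ρ≤1 zero q =
  subst (λ z → ∣ z ∣ ≤ ρ * ρ * ∣ q ∣) (sym (solve 2 (λ ρ q → con 1ℚ :* q :- (q :+ ρ :* con 0ℚ) := con 0ℚ) refl ρ q))
        (*-nonneg (*-nonneg 0≤ρ 0≤ρ) (0≤∣p∣ q))
pow-truncation {ρ} 0≤ρ ρ≤1 (suc zero) q =
  subst (λ z → ∣ z ∣ ≤ ρ * ρ * ∣ q ∣) (sym (solve 2 (λ ρ q → ρ :* con 1ℚ :* q :- (con 0ℚ :+ ρ :* q) := con 0ℚ) refl ρ q))
        (*-nonneg (*-nonneg 0≤ρ 0≤ρ) (0≤∣p∣ q))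
pow-truncation {ρ} 0≤ρ ρ≤1 (suc (suc m)) q = begin
  ∣ ρ * (ρ * P) * q - (0ℚ + ρ * 0ℚ) ∣
    ≡⟨ cong ∣_∣ (solve 3 (λ ρ P q → ρ :* (ρ :* P) :* q :- (con 0ℚ :+ ρ :* con 0ℚ) := (ρ :* ρ) :* (P :* q)) refl ρ P q) ⟩
  ∣ (ρ * ρ) * (P * q) ∣
    ≡⟨ trans (∣p*q∣≡∣p∣*∣q∣ (ρ * ρ) (P * q)) (cong₂ _*_ (0≤p⇒∣p∣≡p ρ²-nonneg) (∣p*q∣≡∣p∣*∣q∣ P q)) ⟩
  (ρ * ρ) * (∣ P ∣ * ∣ q ∣)
    ≤⟨ *-monoˡ-≤-nonneg ρ²-nonneg (*-monoʳ-≤-nonNeg ∣ q ∣ {{∣-∣-nonNeg q}} ∣P∣≤1) ⟩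
  (ρ * ρ) * (1ℚ * ∣ q ∣)
    ≡⟨ cong ((ρ * ρ) *_) (*-identityˡ _) ⟩
  ρ * ρ * ∣ q ∣ ∎
  where
    open ≤-Reasoning
    P : ℚ
    P = pow ρ m
    ρ²-nonneg : 0ℚ ≤ ρ * ρ
    ρ²-nonneg = *-nonneg 0≤ρ 0≤ρ
    ∣P∣≤1 : ∣ P ∣ ≤ 1ℚ
    ∣P∣≤1 with pow-unit-interval 0≤ρ ρ≤1 m
    ... | 0≤P , P≤1 = subst (_≤ 1ℚ) (sym (0≤p⇒∣p∣≡p 0≤P)) P≤1

sum-truncation : ∀ {A : Set} (k : A → ℕ) (c : A → ℚ) {ρ} → 0ℚ ≤ ρ → ρ ≤ 1ℚ → ∀ xs →
  ∣ sumℚ (map (λ a → pow ρ (k a) * c a) xs)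
    - (sumℚ (map (λ a → deg0 (k a) (c a)) xs) + ρ * sumℚ (map (λ a → deg1 (k a) (c a)) xs)) ∣
    ≤ ρ * ρ * sumℚ (map (λ a → ∣ c a ∣) xs)
sum-truncation k c {ρ} 0≤ρ ρ≤1 []ᴸ =
  subst (λ z → ∣ z ∣ ≤ ρ * ρ * 0ℚ) (sym (solve 1 (λ ρ → con 0ℚ :- (con 0ℚ :+ ρ :* con 0ℚ) := con 0ℚ) refl ρ))
        (*-nonneg (*-nonneg 0≤ρ 0≤ρ) ≤-refl)
sum-truncation k c {ρ} 0≤ρ ρ≤1 (a ∷ᴸ xs) = begin
  ∣ (t + Σt) - ((d₀ + Σd₀) + ρ * (d₁ + Σd₁)) ∣
    ≡⟨ cong ∣_∣ (solve 7 (λ ρ t T a A b B → (t :+ T) :- ((a :+ A) :+ ρ :* (b :+ B))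
                          := (t :- (a :+ ρ :* b)) :+ (T :- (A :+ ρ :* B))) refl ρ t Σt d₀ Σd₀ d₁ Σd₁) ⟩
  ∣ (t - (d₀ + ρ * d₁)) + (Σt - (Σd₀ + ρ * Σd₁)) ∣
    ≤⟨ ∣p+q∣≤∣p∣+∣q∣ (t - (d₀ + ρ * d₁)) (Σt - (Σd₀ + ρ * Σd₁)) ⟩
  ∣ t - (d₀ + ρ * d₁) ∣ + ∣ Σt - (Σd₀ + ρ * Σd₁) ∣
    ≤⟨ +-mono-≤ (pow-truncation 0≤ρ ρ≤1 (k a) (c a)) (sum-truncation k c 0≤ρ ρ≤1 xs) ⟩
  ρ * ρ * ∣ c a ∣ + ρ * ρ * sumℚ (map (λ a → ∣ c a ∣) xs)
    ≡⟨ sym (*-distribˡ-+ (ρ * ρ) _ _) ⟩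
  ρ * ρ * (∣ c a ∣ + sumℚ (map (λ a → ∣ c a ∣) xs)) ∎
  where
    open ≤-Reasoning
    t d₀ d₁ Σt Σd₀ Σd₁ : ℚ
    t = pow ρ (k a) * c a
    d₀ = deg0 (k a) (c a)
    d₁ = deg1 (k a) (c a)
    Σt = sumℚ (map (λ a → pow ρ (k a) * c a) xs)
    Σd₀ = sumℚ (map (λ a → deg0 (k a) (c a)) xs)
    Σd₁ = sumℚ (map (λ a → deg1 (k a) (c a)) xs)

noiseBound : ∀ {n} → BoolFun n → Cube n → ℚ
noiseBound {n} f y = sumℚ (map (λ S → ∣ fhat f S * χ S y ∣) (allSubsets n))

T-first-order : ∀ n (f : BoolFun n) y {ρ} → 0ℚ ≤ ρ → ρ ≤ 1ℚ →
  ∣ T ρ f y - (fhat f ∅ + ρ * lin n (coef f) y) ∣ ≤ ρ * ρ * noiseBound f y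
T-first-order n f y {ρ} 0≤ρ ρ≤1 = begin
  ∣ T ρ f y - (fhat f ∅ + ρ * lin n (coef f) y) ∣
    ≡⟨ cong₂ (λ s t → ∣ s - t ∣) T-as-sum (sym (cong₂ (λ s t → s + ρ * t) degree-0 degree-1)) ⟩
  ∣ sumℚ (map (λ S → pow ρ (card S) * c S) Ss)
    - (sumℚ (map (λ S → deg0 (card S) (c S)) Ss) + ρ * sumℚ (map (λ S → deg1 (card S) (c S)) Ss)) ∣
    ≤⟨ sum-truncation card c 0≤ρ ρ≤1 Ss ⟩
  ρ * ρ * noiseBound f y ∎
  where
    open ≤-Reasoning
    Ss : List (Subset n)
    Ss = allSubsets n
    c : Subset n → ℚ
    c S = fhat f S * χ S y
    T-as-sum : T ρ f y ≡ sumℚ (map (λ S → pow ρ (card S) * c S) Ss)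
    T-as-sum = cong sumℚ (map-cong (λ S → *-assoc (pow ρ (card S)) (fhat f S) (χ S y)) Ss)
    degree-0 : sumℚ (map (λ S → deg0 (card S) (c S)) Ss) ≡ fhat f ∅
    degree-0 = trans (sum-deg0 n c) (trans (cong (fhat f ∅ *_) (χ-∅ n y)) (*-identityʳ _))
    degree-1 : sumℚ (map (λ S → deg1 (card S) (c S)) Ss) ≡ lin n (coef f) y
    degree-1 = trans (sum-deg1 n c) (sumFin-cong n (λ i → cong (coef f i *_) (χ-singleton n i y)))

nonneg-nonzero⇒pos : ∀ {q} → 0ℚ ≤ q → ¬ (q ≡ 0ℚ) → 0ℚ < q
nonneg-nonzero⇒pos {q} 0≤q q≢0 with <-cmp 0ℚ q
... | tri< 0<q _ _ = 0<q
... | tri≈ _ 0≡q _ = ⊥-elim (q≢0 (sym 0≡q))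
... | tri> _ _ q<0 = ⊥-elim (<-irrefl refl (<-≤-trans q<0 0≤q))

sgn-pos : ∀ {q} → 0ℚ < q → sgn q ≡ 1ℚ
sgn-pos {q} 0<q with 0ℚ <? q
... | yes _   = refl
... | no 0≮q = ⊥-elim (0≮q 0<q)

sgn-neg : ∀ {q} → q < 0ℚ → sgn q ≡ - 1ℚ
sgn-neg {q} q<0 with 0ℚ <? q
... | yes 0<q = ⊥-elim (<-asym q<0 0<q)
... | no _ with q <? 0ℚ
...   | yes _   = refl
...   | no q≮0 = ⊥-elim (q≮0 q<0)

sgn-mul-self : ∀ q → sgn q * q ≡ ∣ q ∣
sgn-mul-self q with <-cmp 0ℚ q
... | tri< 0<q _ _ = trans (cong (_* q) (sgn-pos 0<q)) (trans (*-identityˡ q) (sym (0≤p⇒∣p∣≡p (<⇒≤ 0<q))))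
... | tri≈ _ 0≡q _ = subst (λ z → sgn z * z ≡ ∣ z ∣) 0≡q refl
... | tri> _ _ q<0 = trans (cong (_* q) (sgn-neg q<0))
  (trans (solve 1 (λ q → con (- 1ℚ) :* q := :- q) refl q) (sym (∣p∣≡-p-if-neg q<0)))

sgn-scale : ∀ {ρ} → 0ℚ < ρ → ∀ q → sgn (ρ * q) ≡ sgn q
sgn-scale {ρ} 0<ρ q with <-cmp 0ℚ q
... | tri< 0<q _ _ = trans (sgn-pos (subst (_< ρ * q) (*-zeroʳ ρ) (*-monoʳ-<-pos ρ {{positive 0<ρ}} 0<q)))
                           (sym (sgn-pos 0<q))
... | tri≈ _ 0≡q _ = subst (λ z → sgn (ρ * z) ≡ sgn z) 0≡q (cong sgn (*-zeroʳ ρ))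
... | tri> _ _ q<0 = trans (sgn-neg (subst (ρ * q <_) (*-zeroʳ ρ) (*-monoʳ-<-pos ρ {{positive 0<ρ}} q<0)))
                           (sym (sgn-neg q<0))

close⇒nonzero : ∀ {t m} → ∣ t - m ∣ < ∣ m ∣ → ¬ (t ≡ 0ℚ)
close⇒nonzero {t} {m} close t≡0 = <-irrefl ∣0-m∣≡∣m∣ (subst (λ z → ∣ z - m ∣ < ∣ m ∣) t≡0 close)
  where
    ∣0-m∣≡∣m∣ : ∣ 0ℚ - m ∣ ≡ ∣ m ∣
    ∣0-m∣≡∣m∣ = trans (cong ∣_∣ (+-identityˡ (- m))) (∣-p∣≡∣p∣ m)

sgn-stable : ∀ {t m} → ∣ t - m ∣ < ∣ m ∣ → sgn t ≡ sgn m
sgn-stable {t} {m} close with <-cmp 0ℚ m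
... | tri< 0<m _ _ = trans (sgn-pos 0<t) (sym (sgn-pos 0<m))
  where
    0<t : 0ℚ < t
    0<t = <-≤-trans {0ℚ} {m - ∣ t - m ∣} (gap-pos (subst (∣ t - m ∣ <_) (0≤p⇒∣p∣≡p (<⇒≤ 0<m)) close))
                    (≤-from-gap (gap-nonneg (-p≤∣p∣ (t - m)))
                       (solve 3 (λ t m A → A :- (:- (t :- m)) := t :- (m :- A)) refl t m ∣ t - m ∣))
... | tri≈ _ 0≡m _ = ⊥-elim (<-irrefl refl (≤-<-trans (0≤∣p∣ (t - m)) (subst (λ z → ∣ t - m ∣ < ∣ z ∣) (sym 0≡m) close)))
... | tri> _ _ m<0 = trans (sgn-neg t<0) (sym (sgn-neg m<0))
  where
    t<0 : t < 0ℚ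
    t<0 = ≤-<-trans {t} {m + ∣ t - m ∣} (≤-from-gap (gap-nonneg (p≤∣p∣ (t - m)))
                       (solve 3 (λ t m A → A :- (t :- m) := (m :+ A) :- t) refl t m ∣ t - m ∣))
                    (<-from-gap (gap-pos (subst (∣ t - m ∣ <_) (∣p∣≡-p-if-neg m<0) close))
                       (solve 2 (λ m A → :- m :- A := con 0ℚ :- (m :+ A)) refl m ∣ t - m ∣))

⊓-pos : ∀ {p q} → 0ℚ < p → 0ℚ < q → 0ℚ < p ⊓ q
⊓-pos {p} {q} 0<p 0<q with ⊓-sel p q
... | inj₁ p⊓q≡p = subst (0ℚ <_) (sym p⊓q≡p) 0<p
... | inj₂ p⊓q≡q = subst (0ℚ <_) (sym p⊓q≡q) 0<q

below-ratio : ∀ {M B} → 0ℚ < M → 0ℚ ≤ B → Σ ℚ λ t → (0ℚ < t) × (t * B < M)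
below-ratio {M} {B} 0<M 0≤B = t , 0<t , tB<M
  where
    0<B+1 : 0ℚ < B + 1ℚ
    0<B+1 = <-≤-trans (positive⁻¹ 1ℚ) (subst (_≤ B + 1ℚ) (+-identityˡ 1ℚ) (+-monoˡ-≤ 1ℚ 0≤B))
    instance
      B+1≢0 : NonZero (B + 1ℚ)
      B+1≢0 = pos⇒nonZero (B + 1ℚ) {{positive 0<B+1}}
    t : ℚ
    t = M * 1/ (B + 1ℚ)
    0<t : 0ℚ < t
    0<t = positive⁻¹ t {{pos*pos⇒pos M {{positive 0<M}} (1/ (B + 1ℚ)) {{1/pos⇒pos (B + 1ℚ) {{positive 0<B+1}}}}}}
    t[B+1]≡M : t * (B + 1ℚ) ≡ M
    t[B+1]≡M = trans (*-assoc M _ _) (trans (cong (M *_) (*-inverseˡ (B + 1ℚ))) (*-identityʳ M))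
    tB<M : t * B < M
    tB<M = <-from-gap 0<t (trans (solve 2 (λ t B → t := t :* (B :+ con 1ℚ) :- t :* B) refl t B)
                                 (cong (_- t * B) t[B+1]≡M))

small-parameter : ∀ {ρ* B M} → 0ℚ < ρ* → 0ℚ ≤ B → (Σ ℚ λ t → (0ℚ < t) × (t * B < M)) →
  Σ ℚ λ ρ → (0ℚ < ρ) × (ρ < ρ*) × (ρ ≤ 1ℚ) × (ρ * B < M)
small-parameter {ρ*} {B} {M} 0<ρ* 0≤B (t , 0<t , tB<M) = ρ , 0<ρ , ρ<ρ* , ρ≤1 , ρB<M
  where
    ρ : ℚ
    ρ = (½ * ρ*) ⊓ (1ℚ ⊓ t)
    0<½ρ* : 0ℚ < ½ * ρ*
    0<½ρ* = positive⁻¹ (½ * ρ*) {{pos*pos⇒pos ½ ρ* {{positive 0<ρ*}}}}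
    0<ρ : 0ℚ < ρ
    0<ρ = ⊓-pos 0<½ρ* (⊓-pos (positive⁻¹ 1ℚ) 0<t)
    ρ<ρ* : ρ < ρ*
    ρ<ρ* = ≤-<-trans (p⊓q≤p (½ * ρ*) (1ℚ ⊓ t))
                     (<-from-gap 0<½ρ* (solve 1 (λ r → con ½ :* r := r :- con ½ :* r) refl ρ*))
    ρ≤1 : ρ ≤ 1ℚ
    ρ≤1 = ≤-trans (p⊓q≤q (½ * ρ*) (1ℚ ⊓ t)) (p⊓q≤p 1ℚ t)
    ρB<M : ρ * B < M
    ρB<M = ≤-<-trans (*-monoʳ-≤-nonNeg B {{nonNegative 0≤B}} (≤-trans (p⊓q≤q (½ * ρ*) (1ℚ ⊓ t)) (p⊓q≤q 1ℚ t))) tB<M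

T-at-zero : ∀ n (f : BoolFun n) y → T 0ℚ f y ≡ fhat f ∅
T-at-zero n f y = begin
  T 0ℚ f y                 ≡⟨ solve 2 (λ T a → T := (T :- a) :+ a) refl (T 0ℚ f y) a ⟩
  (T 0ℚ f y - a) + a       ≡⟨ cong (_+ a) difference-vanishes ⟩
  0ℚ + a                   ≡⟨ solve 2 (λ c l → con 0ℚ :+ (c :+ con 0ℚ :* l) := c) refl (fhat f ∅) ℓ ⟩
  fhat f ∅                 ∎
  where
    open ≡-Reasoning
    ℓ : ℚ
    ℓ = lin n (coef f) y
    a : ℚ
    a = fhat f ∅ + 0ℚ * ℓ
    no-error : 0ℚ * 0ℚ * noiseBound f y ≡ 0ℚ
    no-error = solve 1 (λ B → con 0ℚ :* con 0ℚ :* B := con 0ℚ) refl (noiseBound f y)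
    difference-vanishes : T 0ℚ f y - a ≡ 0ℚ
    difference-vanishes = ∣p∣≡0⇒p≡0 _ (≤-antisym
      (≤-trans (T-first-order n f y ≤-refl (<⇒≤ (positive⁻¹ 1ℚ))) (≤-reflexive no-error))
      (0≤∣p∣ _))

constant-if-mean-nonzero : ∀ n (f : BoolFun n) → SP 0ℚ f → ¬ (fhat f ∅ ≡ 0ℚ) →
  ∀ y → val (f y) ≡ sgn (fhat f ∅)
constant-if-mean-nonzero n f sp c≢0 y =
  trans (sp y (λ T≡0 → c≢0 (trans (sym (T-at-zero n f y)) T≡0))) (cong sgn (T-at-zero n f y))

T-near-linear : ∀ n (f : BoolFun n) y {ρ} → fhat f ∅ ≡ 0ℚ → 0ℚ < ρ → ρ ≤ 1ℚ →
  ρ * noiseBound f y < ∣ lin n (coef f) y ∣ → ∣ T ρ f y - ρ * lin n (coef f) y ∣ < ∣ ρ * lin n (coef f) y ∣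
T-near-linear n f y {ρ} c≡0 0<ρ ρ≤1 ρB<∣ℓ∣ = begin-strict
  ∣ T ρ f y - ρ * ℓ ∣                   ≡⟨ cong (λ c → ∣ T ρ f y - c ∣) (sym drop-mean) ⟩
  ∣ T ρ f y - (fhat f ∅ + ρ * ℓ) ∣      ≤⟨ T-first-order n f y (<⇒≤ 0<ρ) ρ≤1 ⟩
  ρ * ρ * noiseBound f y                ≡⟨ *-assoc ρ ρ (noiseBound f y) ⟩
  ρ * (ρ * noiseBound f y)              <⟨ *-monoʳ-<-pos ρ {{positive 0<ρ}} ρB<∣ℓ∣ ⟩
  ρ * ∣ ℓ ∣                             ≡⟨ cong (_* ∣ ℓ ∣) (sym (0≤p⇒∣p∣≡p (<⇒≤ 0<ρ))) ⟩
  ∣ ρ ∣ * ∣ ℓ ∣                         ≡⟨ sym (∣p*q∣≡∣p∣*∣q∣ ρ ℓ) ⟩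
  ∣ ρ * ℓ ∣                             ∎
  where
    open ≤-Reasoning
    ℓ : ℚ
    ℓ = lin n (coef f) y
    drop-mean : fhat f ∅ + ρ * ℓ ≡ ρ * ℓ
    drop-mean = trans (cong (_+ ρ * ℓ) c≡0) (+-identityˡ (ρ * ℓ))

sign-follows-lin : ∀ n (f : BoolFun n) → LowCorrSP f → fhat f ∅ ≡ 0ℚ → ∀ y →
  ¬ (lin n (coef f) y ≡ 0ℚ) → val (f y) ≡ sgn (lin n (coef f) y)
sign-follows-lin n f (ρ* , 0<ρ* , sp) c≡0 y ℓ≢0 =
  at-parameter (small-parameter 0<ρ* 0≤B (below-ratio 0<∣ℓ∣ 0≤B))
  where
    open ≡-Reasoning
    ℓ : ℚ
    ℓ = lin n (coef f) y
    0≤B : 0ℚ ≤ noiseBound f y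
    0≤B = sumℚ-abs-nonneg (λ S → fhat f S * χ S y) (allSubsets n)
    0<∣ℓ∣ : 0ℚ < ∣ ℓ ∣
    0<∣ℓ∣ = nonneg-nonzero⇒pos (0≤∣p∣ ℓ) (ℓ≢0 ∘ ∣p∣≡0⇒p≡0 ℓ)
    at-parameter : (Σ ℚ λ ρ → (0ℚ < ρ) × (ρ < ρ*) × (ρ ≤ 1ℚ) × (ρ * noiseBound f y < ∣ ℓ ∣)) → val (f y) ≡ sgn ℓ
    at-parameter (ρ , 0<ρ , ρ<ρ* , ρ≤1 , ρB<∣ℓ∣) = begin
      val (f y)       ≡⟨ sp ρ (<⇒≤ 0<ρ) ρ<ρ* y (close⇒nonzero {T ρ f y} {ρ * ℓ} close) ⟩
      sgn (T ρ f y)   ≡⟨ sgn-stable {T ρ f y} {ρ * ℓ} close ⟩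
      sgn (ρ * ℓ)     ≡⟨ sgn-scale 0<ρ ℓ ⟩
      sgn ℓ           ∎
      where
        close : ∣ T ρ f y - ρ * ℓ ∣ < ∣ ρ * ℓ ∣
        close = T-near-linear n f y c≡0 0<ρ ρ≤1 ρB<∣ℓ∣

E-abs-lin : ∀ n (f : BoolFun n) → LowCorrSP f → fhat f ∅ ≡ 0ℚ →
  E n (λ y → ∣ lin n (coef f) y ∣) ≡ ssq n (coef f)
E-abs-lin n f lc c≡0 = trans (sym (E-cong n aligned)) (E-f-lin n f)
  where
    aligned : ∀ y → val (f y) * lin n (coef f) y ≡ ∣ lin n (coef f) y ∣
    aligned y with lin n (coef f) y ≟ 0ℚ
    ... | yes ℓ≡0 = trans (cong (val (f y) *_) ℓ≡0) (trans (*-zeroʳ (val (f y))) (cong ∣_∣ (sym ℓ≡0)))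
    ... | no ℓ≢0  = trans (cong (_* lin n (coef f) y) (sign-follows-lin n f lc c≡0 y ℓ≢0)) (sgn-mul-self _)

weight-dichotomy : ∀ {W} → 0ℚ ≤ W → ½ * W ≤ W * W → W ≡ 0ℚ ⊎ ½ ≤ W
weight-dichotomy {W} 0≤W half≤square with W ≟ 0ℚ
... | yes W≡0 = inj₁ W≡0
... | no W≢0  = inj₂ (*-cancelʳ-≤-pos W {{positive (nonneg-nonzero⇒pos 0≤W W≢0)}} half≤square)

corollary5p3 : (n : ℕ) (f : BoolFun n) → LowCorrSP f → W1 f ≡ 0ℚ ⊎ ½ ≤ W1 f
corollary5p3 n f lc@(ρ* , 0<ρ* , sp) with fhat f ∅ ≟ 0ℚ
... | no c≢0 = inj₁ (W1-constant n f _ (constant-if-mean-nonzero n f (sp 0ℚ ≤-refl 0<ρ*) c≢0))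
... | yes c≡0 = subst (λ w → w ≡ 0ℚ ⊎ ½ ≤ w) (sym (W1≡ssq n f))
  (weight-dichotomy (ssq-nonneg n a)
    (subst (λ m → ½ * ssq n a ≤ m * m) (E-abs-lin n f lc c≡0) (khintchine n a)))
  where
    a : Fin n → ℚ
    a = coef f
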